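{- Let $G$ be a $q$-cut-dense graph of order $n$. Then for any $U\subseteq V(G)$ with $|U|\le qn/8$, the graph $G\setminus U$ (obtained by deleting the vertices of $U$) is $q/2$-cut-dense.
   Context: A graph $F$ is $q$-cut-dense if for every partition $V(F)=A\cup B$ we have $e_F(A,B)\ge q|A||B|$, where $e_F(A,B)$ is the number of edges of $F$ with one endpoint in $A$ and the other in $B$. -}

module Defs where

open import Data.Nat using (ℕ; zero; suc; _+_)
import Data.Nat
open import Data.Bool using (Bool; true; false; if_then_else_; _∧_)
open import Data.Fin using (Fin)
open import Data.Fin.Subset using (Subset; _⊆_; _─_; ∣_∣; ⊤; _∈_)
open import Data.Vec using (lookup)
open import Data.List using (List; map)
open import Data.Nat.ListAction using (sum)
open import Data.List using () renaming (allFin to finList)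
open import Data.Rational using (ℚ; _≤_; _*_; _/_)
open import Data.Integer using (+_)
open import Relation.Binary.PropositionalEquality using (_≡_)

record Graph (n : ℕ) : Set where
  field
    adj   : Fin n → Fin n → Bool
    sym   : ∀ u v → adj u v ≡ adj v u
    irrefl : ∀ v → adj v v ≡ false
open Graph public

ℕtoℚ : ℕ → ℚ
ℕtoℚ m = (+ m) / 1

b2n : Bool → ℕ
b2n true  = 1
b2n false = 0

-- e_G(A,B): number of ordered pairs (a,b) with a ∈ A, b ∈ B, ab ∈ E(G).
-- For disjoint A, B this is exactly the number of edges with one endpoint
-- in A and the other in B.
eG : ∀ {n} → Graph n → Subset n → Subset n → ℕ
eG {n} G A B =
  sum (map (λ a → sum (map (λ b →
        b2n (lookup A a ∧ (lookup B b ∧ adj G a b))) (finList n))) (finList n))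

-- The induced subgraph G[W] is q-cut-dense: for every partition W = A ∪ B
-- (A ⊆ W, B = W ∖ A) we have e(A,B) ≥ q|A||B|.
-- (Edges of G[W] between A and B are exactly the edges of G between them.)
CutDenseOn : ∀ {n} → ℚ → Graph n → Subset n → Set
CutDenseOn q G W =
  ∀ (A : Subset _) → A ⊆ W →
    q * ℕtoℚ (∣ A ∣ Data.Nat.* ∣ W ─ A ∣) ≤ ℕtoℚ (eG G A (W ─ A))

CutDense : ∀ {n} → ℚ → Graph n → Set
CutDense q G = CutDenseOn q G ⊤

-- Let A ∪ B partition V(G) ∖ U with |A| ≤ |B| (the other case is symmetric). Cut-density of G at
-- the cut (A, B ∪ U) gives e(A,B) + e(A,U) ≥ q|A|(|B| + |U|), and e(A,U) ≤ |A||U|, so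
-- e(A,B) ≥ |A|(q|B| + q|U| − |U|). As |A| ≤ |B|, the hypothesis gives |U| ≤ q(2|B| + |U|)/8,
-- whence q|B| + q|U| − |U| ≥ (3/4)q|B| ≥ (q/2)|B|. For q ≤ 0 there is nothing to prove.

module Submission where

open import Defs hiding (sym)
open import Data.Nat as ℕ using (ℕ)
open import Data.Fin.Subset using (Subset; ∣_∣; ∁)

module RationalBounds where

  open import Data.Nat.Coprimality using (1-coprimeTo)
  import Data.Nat.Coprimality as Coprimality
  open import Data.Integer using (+_)
  import Data.Integer as ℤ
  import Data.Integer.Properties as ℤ
  open import Data.Rational
  open import Data.Rational.Properties
  open import Data.Rational.Solver using (module +-*-Solver)
  open import Function using (_∘_)
  open import Relation.Binary.PropositionalEquality
  open +-*-Solver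

  ⅛ : ℚ
  ⅛ = + 1 / 8

  ℕtoℚ≡mkℚ : ∀ m → ℕtoℚ m ≡ mkℚ (+ m) 0 (Coprimality.sym (1-coprimeTo m))
  ℕtoℚ≡mkℚ m = normalize-coprime (Coprimality.sym (1-coprimeTo m))

  ℕtoℚ-+ : ∀ a b → ℕtoℚ (a ℕ.+ b) ≡ ℕtoℚ a + ℕtoℚ b
  ℕtoℚ-+ a b rewrite ℕtoℚ≡mkℚ a | ℕtoℚ≡mkℚ b =
    sym (cong (_/ 1) (cong₂ ℤ._+_ (ℤ.*-identityʳ (+ a)) (ℤ.*-identityʳ (+ b))))

  ℕtoℚ-* : ∀ a b → ℕtoℚ (a ℕ.* b) ≡ ℕtoℚ a * ℕtoℚ b
  ℕtoℚ-* a b rewrite ℕtoℚ≡mkℚ a | ℕtoℚ≡mkℚ b = cong (_/ 1) (ℤ.pos-* a b)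

  ℕtoℚ-mono-≤ : ∀ {a b} → a ℕ.≤ b → ℕtoℚ a ≤ ℕtoℚ b
  ℕtoℚ-mono-≤ {a} {b} a≤b rewrite ℕtoℚ≡mkℚ a | ℕtoℚ≡mkℚ b =
    *≤* (subst₂ ℤ._≤_ (sym (ℤ.*-identityʳ (+ a))) (sym (ℤ.*-identityʳ (+ b))) (ℤ.+≤+ a≤b))

  ℕtoℚ-nonNeg : ∀ m → 0ℚ ≤ ℕtoℚ m
  ℕtoℚ-nonNeg m = ℕtoℚ-mono-≤ {0} {m} ℕ.z≤n

  +-cancelʳ-≤ : ∀ {p q} r → p + r ≤ q + r → p ≤ q
  +-cancelʳ-≤ {p} {q} r = subst₂ _≤_ (x+r-r≡x p) (x+r-r≡x q) ∘ +-monoˡ-≤ (- r)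
    where
    x+r-r≡x : ∀ x → x + r - r ≡ x
    x+r-r≡x x = solve 2 (λ x r → x :+ r :- r := x) refl x r

  p≤p+q : ∀ p {q} → 0ℚ ≤ q → p ≤ p + q
  p≤p+q p 0≤q = subst (_≤ p + _) (+-identityʳ p) (+-monoʳ-≤ p 0≤q)

  nonNeg*nonNeg⇒0≤ : ∀ {p q} → 0ℚ ≤ p → 0ℚ ≤ q → 0ℚ ≤ p * q
  nonNeg*nonNeg⇒0≤ {p} {q} 0≤p 0≤q =
    nonNegative⁻¹ (p * q) {{nonNeg*nonNeg⇒nonNeg p {{nonNegative 0≤p}} q {{nonNegative 0≤q}}}}

  nonPos*nonNeg≤nonNeg : ∀ {p q r} → p ≤ 0ℚ → 0ℚ ≤ q → 0ℚ ≤ r → p * q ≤ r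
  nonPos*nonNeg≤nonNeg {p} {q} p≤0 0≤q 0≤r =
    ≤-trans (subst (p * q ≤_) (*-zeroˡ q) (*-monoʳ-≤-nonNeg q {{nonNegative 0≤q}} p≤0)) 0≤r

  -- s and l are the sizes of the smaller and larger side, u that of the deleted set, and e₁, e₂
  -- the numbers of edges from the smaller side to the larger side and to the deleted set.
  cut-after-deletion : ∀ {q s l u e₁ e₂} → 0ℚ ≤ q → 0ℚ ≤ s → 0ℚ ≤ u → s ≤ l →
                       q * (s * (l + u)) ≤ e₁ + e₂ → e₂ ≤ s * u → u ≤ q * (s + l + u) * ⅛ →
                       q * ½ * (s * l) ≤ e₁
  cut-after-deletion {q} {s} {l} {u} {e₁} {e₂} 0≤q 0≤s 0≤u s≤l cut e₂≤su u≤ =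
    +-cancelʳ-≤ e₂ (begin
      X + e₂             ≤⟨ +-monoʳ-≤ X (≤-trans e₂≤su (*-monoˡ-≤-nonNeg s {{nonNegative 0≤s}} u≤′)) ⟩
      X + T              ≤⟨ p≤p+q (X + T) slack≥0 ⟩
      X + T + slack      ≡⟨ split ⟩
      q * (s * (l + u))  ≤⟨ cut ⟩
      e₁ + e₂            ∎)
    where
    open ≤-Reasoning
    X = q * ½ * (s * l)
    T = s * (q * (l + l + u) * ⅛)
    slack = q * (s * (l * (+ 1 / 4) + u * (+ 7 / 8)))
    u≤′ : u ≤ q * (l + l + u) * ⅛
    u≤′ = ≤-trans u≤ (*-monoʳ-≤-nonNeg ⅛
            (*-monoˡ-≤-nonNeg q {{nonNegative 0≤q}} (+-monoˡ-≤ u (+-monoˡ-≤ l s≤l))))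
    slack≥0 : 0ℚ ≤ slack
    slack≥0 = nonNeg*nonNeg⇒0≤ 0≤q (nonNeg*nonNeg⇒0≤ 0≤s (+-mono-≤
                (nonNeg*nonNeg⇒0≤ (≤-trans 0≤s s≤l) (nonNegative⁻¹ _))
                (nonNeg*nonNeg⇒0≤ 0≤u (nonNegative⁻¹ _))))
    split : X + T + slack ≡ q * (s * (l + u))
    split = solve 4 (λ q s l u →
              q :* con ½ :* (s :* l) :+ s :* (q :* (l :+ l :+ u) :* con ⅛)
                :+ q :* (s :* (l :* con (+ 1 / 4) :+ u :* con (+ 7 / 8)))
              := q :* (s :* (l :+ u))) refl q s l u

module Counting where

  open import Data.Nat using (zero; suc; _+_; _*_; _≤_; z≤n)
  open import Data.Nat.Properties
    using (+-*-semiring; *-commutativeSemigroup; +-comm; +-assoc; +-mono-≤; *-monoʳ-≤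
          ; *-identityˡ; *-identityʳ; *-zeroʳ; *-distribˡ-+; *-distribʳ-+; ≤-reflexive; ≤-trans
          ; module ≤-Reasoning)
  open import Data.Bool using (true; false; not; _∧_)
  open import Data.Bool.Properties using (∧-zeroʳ; ∧-identityʳ; ¬-not)
  open import Data.Fin using (Fin; zero; suc)
  open import Data.Fin.Subset using (_─_; ⊤; _⊆_; inside; outside)
  open import Data.Fin.Subset.Properties using (x∈∁p⇒x∉p; ∣⊤∣≡n)
  open import Data.Vec using (lookup; _∷_; [])
  open import Data.Vec.Properties using (lookup-map; lookup-replicate; lookup⇒[]=)
  open import Data.List using (tabulate; map; allFin)
  open import Data.List.Properties using (map-tabulate)
  open import Data.Nat.ListAction using (sum)
  open import Algebra.Properties.CommutativeSemigroup *-commutativeSemigroup using (x∙yz≈y∙xz)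
  open import Algebra.Properties.Semiring.Sum +-*-semiring
    using (sum-syntax; sum-cong-≗; ∑-distrib-+; ∑-comm; *-distribˡ-sum; *-distribʳ-sum)
    renaming (sum to ∑)
  open import Relation.Binary.PropositionalEquality

  sum-map-allFin : ∀ {n} (f : Fin n → ℕ) → sum (map f (allFin n)) ≡ ∑[ i < n ] f i
  sum-map-allFin {n} f = trans (cong sum (map-tabulate (λ i → i) f)) (sum-tabulate f)
    where
    sum-tabulate : ∀ {n} (f : Fin n → ℕ) → sum (tabulate f) ≡ ∑[ i < n ] f i
    sum-tabulate {zero}  f = refl
    sum-tabulate {suc n} f = cong (f zero +_) (sum-tabulate (λ i → f (suc i)))

  ∑-mono-≤ : ∀ {n} {f g : Fin n → ℕ} → (∀ i → f i ≤ g i) → ∑[ i < n ] f i ≤ ∑[ i < n ] g i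
  ∑-mono-≤ {zero}  f≤g = z≤n
  ∑-mono-≤ {suc n} f≤g = +-mono-≤ (f≤g zero) (∑-mono-≤ (λ i → f≤g (suc i)))

  b2n-∧ : ∀ x y → b2n (x ∧ y) ≡ b2n x * b2n y
  b2n-∧ true  y = sym (*-identityˡ (b2n y))
  b2n-∧ false y = refl

  m*b2n≤m : ∀ m x → m * b2n x ≤ m
  m*b2n≤m m true  = ≤-reflexive (*-identityʳ m)
  m*b2n≤m m false = ≤-trans (≤-reflexive (*-zeroʳ m)) z≤n

  𝟙 : ∀ {n} → Subset n → Fin n → ℕ
  𝟙 A i = b2n (lookup A i)

  ∣∣≡∑𝟙 : ∀ {n} (A : Subset n) → ∣ A ∣ ≡ ∑[ i < n ] 𝟙 A i
  ∣∣≡∑𝟙 []            = refl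
  ∣∣≡∑𝟙 (inside  ∷ A) = cong suc (∣∣≡∑𝟙 A)
  ∣∣≡∑𝟙 (outside ∷ A) = ∣∣≡∑𝟙 A

  ∣∣-split : ∀ {n} (X Y Z : Subset n) → (∀ i → 𝟙 X i ≡ 𝟙 Y i + 𝟙 Z i) → ∣ X ∣ ≡ ∣ Y ∣ + ∣ Z ∣
  ∣∣-split {n} X Y Z X≡Y+Z = begin
    ∣ X ∣                                      ≡⟨ ∣∣≡∑𝟙 X ⟩
    ∑[ i < n ] 𝟙 X i                           ≡⟨ sum-cong-≗ X≡Y+Z ⟩
    ∑[ i < n ] (𝟙 Y i + 𝟙 Z i)                 ≡⟨ ∑-distrib-+ (𝟙 Y) (𝟙 Z) ⟩
    ∑[ i < n ] 𝟙 Y i + ∑[ i < n ] 𝟙 Z i        ≡⟨ cong₂ _+_ (∣∣≡∑𝟙 Y) (∣∣≡∑𝟙 Z) ⟨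
    ∣ Y ∣ + ∣ Z ∣                              ∎
    where open ≡-Reasoning

  edgeForm : ∀ {n} → Graph n → (Fin n → ℕ) → (Fin n → ℕ) → ℕ
  edgeForm {n} G f g = ∑[ a < n ] ∑[ b < n ] (f a * (g b * b2n (adj G a b)))

  eG≡edgeForm : ∀ {n} (G : Graph n) (A B : Subset n) → eG G A B ≡ edgeForm G (𝟙 A) (𝟙 B)
  eG≡edgeForm {n} G A B = begin
    eG G A B
      ≡⟨ sum-map-allFin {n} _ ⟩
    ∑[ a < n ] sum (map (λ b → b2n (lookup A a ∧ (lookup B b ∧ adj G a b))) (allFin n))
      ≡⟨ sum-cong-≗ {n} (λ a → sum-map-allFin {n} _) ⟩
    ∑[ a < n ] ∑[ b < n ] b2n (lookup A a ∧ (lookup B b ∧ adj G a b))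
      ≡⟨ sum-cong-≗ (λ a → sum-cong-≗ (λ b →
           trans (b2n-∧ (lookup A a) _) (cong (𝟙 A a *_) (b2n-∧ (lookup B b) _)))) ⟩
    edgeForm G (𝟙 A) (𝟙 B) ∎
    where open ≡-Reasoning

  edgeForm-linearʳ : ∀ {n} (G : Graph n) f {g g₁ g₂ : Fin n → ℕ} → (∀ b → g b ≡ g₁ b + g₂ b) →
                     edgeForm G f g ≡ edgeForm G f g₁ + edgeForm G f g₂
  edgeForm-linearʳ {n} G f {g} {g₁} {g₂} g≡g₁+g₂ = begin
    edgeForm G f g
      ≡⟨ sum-cong-≗ (λ a → sum-cong-≗ (λ b → split a b)) ⟩
    ∑[ a < n ] ∑[ b < n ] (term g₁ a b + term g₂ a b)
      ≡⟨ sum-cong-≗ (λ a → ∑-distrib-+ (term g₁ a) (term g₂ a)) ⟩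
    ∑[ a < n ] (∑[ b < n ] term g₁ a b + ∑[ b < n ] term g₂ a b)
      ≡⟨ ∑-distrib-+ (λ a → ∑[ b < n ] term g₁ a b) (λ a → ∑[ b < n ] term g₂ a b) ⟩
    edgeForm G f g₁ + edgeForm G f g₂ ∎
    where
    open ≡-Reasoning
    term : (Fin n → ℕ) → Fin n → Fin n → ℕ
    term h a b = f a * (h b * b2n (adj G a b))
    split : ∀ a b → term g a b ≡ term g₁ a b + term g₂ a b
    split a b rewrite g≡g₁+g₂ b | *-distribʳ-+ (b2n (adj G a b)) (g₁ b) (g₂ b) =
      *-distribˡ-+ (f a) _ _

  edgeForm-comm : ∀ {n} (G : Graph n) f g → edgeForm G f g ≡ edgeForm G g f
  edgeForm-comm {n} G f g = trans (∑-comm {n} {n} _) (sum-cong-≗ {n} (λ b → sum-cong-≗ {n} (λ a →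
    trans (x∙yz≈y∙xz (f a) (g b) _)
          (cong (λ e → g b * (f a * b2n e)) (Graph.sym G a b)))))

  edgeForm-≤ : ∀ {n} (G : Graph n) f g → edgeForm G f g ≤ (∑[ a < n ] f a) * (∑[ b < n ] g b)
  edgeForm-≤ {n} G f g = begin
    edgeForm G f g
      ≤⟨ ∑-mono-≤ (λ a → ∑-mono-≤ (λ b → *-monoʳ-≤ (f a) (m*b2n≤m (g b) (adj G a b)))) ⟩
    ∑[ a < n ] ∑[ b < n ] (f a * g b)
      ≡⟨ sum-cong-≗ (λ a → *-distribˡ-sum (f a) g) ⟨
    ∑[ a < n ] (f a * ∑[ b < n ] g b)
      ≡⟨ *-distribʳ-sum (∑[ b < n ] g b) f ⟨
    (∑[ a < n ] f a) * (∑[ b < n ] g b) ∎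
    where open ≤-Reasoning

  eG-splitʳ : ∀ {n} (G : Graph n) (A X Y Z : Subset n) → (∀ i → 𝟙 X i ≡ 𝟙 Y i + 𝟙 Z i) →
              eG G A X ≡ eG G A Y + eG G A Z
  eG-splitʳ G A X Y Z X≡Y+Z rewrite eG≡edgeForm G A X | eG≡edgeForm G A Y | eG≡edgeForm G A Z =
    edgeForm-linearʳ G (𝟙 A) {𝟙 X} {𝟙 Y} {𝟙 Z} X≡Y+Z

  eG-comm : ∀ {n} (G : Graph n) A B → eG G A B ≡ eG G B A
  eG-comm G A B rewrite eG≡edgeForm G A B | eG≡edgeForm G B A = edgeForm-comm G (𝟙 A) (𝟙 B)

  eG≤∣∣*∣∣ : ∀ {n} (G : Graph n) A B → eG G A B ≤ ∣ A ∣ * ∣ B ∣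
  eG≤∣∣*∣∣ G A B rewrite eG≡edgeForm G A B | ∣∣≡∑𝟙 A | ∣∣≡∑𝟙 B = edgeForm-≤ G (𝟙 A) (𝟙 B)

  lookup-─ : ∀ {n} (p q : Subset n) i → lookup (p ─ q) i ≡ lookup p i ∧ not (lookup q i)
  lookup-─ (x ∷ p) (inside  ∷ q) zero    = sym (∧-zeroʳ x)
  lookup-─ (x ∷ p) (outside ∷ q) zero    = sym (∧-identityʳ x)
  lookup-─ (_ ∷ p) (_       ∷ q) (suc i) = lookup-─ p q i

  record Partition₃ {n} (X Y Z : Subset n) : Set where
    constructor partition₃
    field covers-once : ∀ i → 𝟙 X i + 𝟙 Y i + 𝟙 Z i ≡ 1
  open Partition₃ public

  Partition₃-swap : ∀ {n} {X Y Z : Subset n} → Partition₃ X Y Z → Partition₃ Y X Z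
  Partition₃-swap {X = X} {Y} {Z} P = partition₃ λ i →
    trans (cong (_+ 𝟙 Z i) (+-comm (𝟙 Y i) (𝟙 X i))) (covers-once P i)

  𝟙-⊤─ : ∀ {n} {X Y Z : Subset n} → Partition₃ X Y Z → ∀ i → 𝟙 (⊤ ─ X) i ≡ 𝟙 Y i + 𝟙 Z i
  𝟙-⊤─ {n} {X} {Y} {Z} P i rewrite lookup-─ ⊤ X i | lookup-replicate {n = n} i true
    with lookup X i | lookup Y i | lookup Z i | covers-once P i
  ... | true  | false | false | _ = refl
  ... | false | true  | false | _ = refl
  ... | false | false | true  | _ = refl

  Partition₃-size : ∀ {n} {X Y Z : Subset n} → Partition₃ X Y Z → n ≡ ∣ X ∣ + ∣ Y ∣ + ∣ Z ∣
  Partition₃-size {n} {X} {Y} {Z} P = begin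
    n                           ≡⟨ ∣⊤∣≡n n ⟨
    ∣ ⊤ {n} ∣                   ≡⟨ ∣∣-split ⊤ X (⊤ ─ X) 𝟙⊤≡𝟙X+𝟙⊤─X ⟩
    ∣ X ∣ + ∣ ⊤ ─ X ∣           ≡⟨ cong (∣ X ∣ +_) (∣∣-split (⊤ ─ X) Y Z (𝟙-⊤─ P)) ⟩
    ∣ X ∣ + (∣ Y ∣ + ∣ Z ∣)     ≡⟨ +-assoc (∣ X ∣) (∣ Y ∣) (∣ Z ∣) ⟨
    ∣ X ∣ + ∣ Y ∣ + ∣ Z ∣       ∎
    where
    open ≡-Reasoning
    𝟙⊤≡𝟙X+𝟙⊤─X : ∀ i → 𝟙 ⊤ i ≡ 𝟙 X i + 𝟙 (⊤ ─ X) i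
    𝟙⊤≡𝟙X+𝟙⊤─X i = begin
      𝟙 ⊤ i                       ≡⟨ cong b2n (lookup-replicate {n = n} i true) ⟩
      1                           ≡⟨ covers-once P i ⟨
      𝟙 X i + 𝟙 Y i + 𝟙 Z i       ≡⟨ +-assoc (𝟙 X i) _ _ ⟩
      𝟙 X i + (𝟙 Y i + 𝟙 Z i)     ≡⟨ cong (𝟙 X i +_) (𝟙-⊤─ P i) ⟨
      𝟙 X i + 𝟙 (⊤ ─ X) i         ∎

  ⊆∁⇒lookup≡false : ∀ {n} {U A : Subset n} → A ⊆ ∁ U → ∀ i → lookup A i ≡ true → lookup U i ≡ false
  ⊆∁⇒lookup≡false {U = U} {A} A⊆∁U i Ai =
    ¬-not (λ Ui → x∈∁p⇒x∉p (A⊆∁U (lookup⇒[]= i A Ai)) (lookup⇒[]= i U Ui))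

  ∁-─-partition₃ : ∀ {n} {U A : Subset n} → A ⊆ ∁ U → Partition₃ A (∁ U ─ A) U
  ∁-─-partition₃ {U = U} {A} A⊆∁U = partition₃ covers
    where
    covers : ∀ i → 𝟙 A i + 𝟙 (∁ U ─ A) i + 𝟙 U i ≡ 1
    covers i rewrite lookup-─ (∁ U) A i | lookup-map i not U
      with lookup A i | lookup U i | ⊆∁⇒lookup≡false A⊆∁U i
    ... | true  | false | _   = refl
    ... | false | true  | _   = refl
    ... | false | false | _   = refl
    ... | true  | true  | U∌i with U∌i refl
    ...   | ()

open import Data.Integer using (+_)
open import Data.Rational using (ℚ; 0ℚ; _≤_; _+_; _*_; _/_; ½)
import Data.Nat.Properties as ℕₚ
open import Data.Rational.Properties using (≤-total; ≤-refl; nonNegative⁻¹; module ≤-Reasoning)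
open import Data.Fin.Subset using (_─_; ⊤)
open import Data.Fin.Subset.Properties using (⊆⊤)
open import Data.Sum using (inj₁; inj₂)
open import Relation.Binary.PropositionalEquality using (_≡_; refl; sym; trans; cong; subst; subst₂)
open RationalBounds
open Counting
  using (Partition₃; Partition₃-swap; Partition₃-size; ∁-─-partition₃; 𝟙-⊤─; ∣∣-split; eG-splitʳ; eG-comm; eG≤∣∣*∣∣)

smaller-side-cut : ∀ {n q} {G : Graph n} {X Y Z : Subset n} → CutDense q G → 0ℚ ≤ q →
                   Partition₃ X Y Z → ∣ X ∣ ℕ.≤ ∣ Y ∣ → ℕtoℚ ∣ Z ∣ ≤ q * ℕtoℚ n * ⅛ →
                   q * ½ * ℕtoℚ (∣ X ∣ ℕ.* ∣ Y ∣) ≤ ℕtoℚ (eG G X Y)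
smaller-side-cut {n} {q} {G} {X} {Y} {Z} cd 0≤q P X≤Y Z≤qn/8 =
  subst (λ t → q * ½ * t ≤ ℕtoℚ (eG G X Y)) (sym (ℕtoℚ-* ∣ X ∣ ∣ Y ∣))
    (cut-after-deletion 0≤q (ℕtoℚ-nonNeg ∣ X ∣) (ℕtoℚ-nonNeg ∣ Z ∣) (ℕtoℚ-mono-≤ X≤Y)
      cut e₂≤xz (subst (λ m → z ≤ q * m * ⅛) n≡x+y+z Z≤qn/8))
  where
  open ≤-Reasoning
  x = ℕtoℚ ∣ X ∣
  y = ℕtoℚ ∣ Y ∣
  z = ℕtoℚ ∣ Z ∣
  n≡x+y+z : ℕtoℚ n ≡ x + y + z
  n≡x+y+z = trans (cong ℕtoℚ (Partition₃-size P))
              (trans (ℕtoℚ-+ (∣ X ∣ ℕ.+ ∣ Y ∣) ∣ Z ∣) (cong (_+ z) (ℕtoℚ-+ ∣ X ∣ ∣ Y ∣)))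
  cut : q * (x * (y + z)) ≤ ℕtoℚ (eG G X Y) + ℕtoℚ (eG G X Z)
  cut = begin
    q * (x * (y + z))               ≡⟨ cong (q *_) (trans (ℕtoℚ-* ∣ X ∣ _) (cong (x *_) (ℕtoℚ-+ ∣ Y ∣ ∣ Z ∣))) ⟨
    q * ℕtoℚ (∣ X ∣ ℕ.* (∣ Y ∣ ℕ.+ ∣ Z ∣))
                                    ≡⟨ cong (λ m → q * ℕtoℚ (∣ X ∣ ℕ.* m)) (∣∣-split (⊤ ─ X) Y Z (𝟙-⊤─ P)) ⟨
    q * ℕtoℚ (∣ X ∣ ℕ.* ∣ ⊤ ─ X ∣)  ≤⟨ cd X ⊆⊤ ⟩
    ℕtoℚ (eG G X (⊤ ─ X))           ≡⟨ cong ℕtoℚ (eG-splitʳ G X (⊤ ─ X) Y Z (𝟙-⊤─ P)) ⟩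
    ℕtoℚ (eG G X Y ℕ.+ eG G X Z)    ≡⟨ ℕtoℚ-+ (eG G X Y) (eG G X Z) ⟩
    ℕtoℚ (eG G X Y) + ℕtoℚ (eG G X Z) ∎
  e₂≤xz : ℕtoℚ (eG G X Z) ≤ x * z
  e₂≤xz = subst (ℕtoℚ (eG G X Z) ≤_) (ℕtoℚ-* ∣ X ∣ ∣ Z ∣) (ℕtoℚ-mono-≤ (eG≤∣∣*∣∣ G X Z))

halved-cut : ∀ {n q} {G : Graph n} {X Y Z : Subset n} → CutDense q G → 0ℚ ≤ q →
             Partition₃ X Y Z → ℕtoℚ ∣ Z ∣ ≤ q * ℕtoℚ n * ⅛ →
             q * ½ * ℕtoℚ (∣ X ∣ ℕ.* ∣ Y ∣) ≤ ℕtoℚ (eG G X Y)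
halved-cut {q = q} {G} {X} {Y} cd 0≤q P Z≤qn/8 with ℕₚ.≤-total ∣ X ∣ ∣ Y ∣
... | inj₁ X≤Y = smaller-side-cut {G = G} cd 0≤q P X≤Y Z≤qn/8
... | inj₂ Y≤X = subst₂ (λ s e → q * ½ * ℕtoℚ s ≤ ℕtoℚ e) (ℕₚ.*-comm ∣ Y ∣ ∣ X ∣) (eG-comm G Y X)
                   (smaller-side-cut {G = G} cd 0≤q (Partition₃-swap P) Y≤X Z≤qn/8)

lemma3p7 : ∀ {n : ℕ} (q : ℚ) (G : Graph n) → CutDense q G →
    (U : Subset n) → ℕtoℚ ∣ U ∣ ≤ q * ℕtoℚ n * ((+ 1) / 8) →
    CutDenseOn (q * ½) G (∁ U)
lemma3p7 q G cd U U≤qn/8 A A⊆∁U with ≤-total q 0ℚ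
... | inj₁ q≤0 = nonPos*nonNeg≤nonNeg (nonPos*nonNeg≤nonNeg q≤0 (nonNegative⁻¹ ½) ≤-refl)
                   (ℕtoℚ-nonNeg (∣ A ∣ ℕ.* ∣ ∁ U ─ A ∣)) (ℕtoℚ-nonNeg (eG G A (∁ U ─ A)))
... | inj₂ 0≤q = halved-cut {G = G} cd 0≤q (∁-─-partition₃ A⊆∁U) U≤qn/8
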